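{- Let $\mathcal{F}\subseteq\binom{[n]}{k}$ be a $t$-intersecting family and $S$ an $s$-subset of $[n]$, where $t-1\leq s\leq k-1$. If there exists $F'\in\mathcal{F}$ with $|S\cap F'|=r\leq t-1$, then for each $i\in\{1,2,\ldots,t-r\}$ there exists an $(s+i)$-subset $T_i$ of $[n]$ with $S\subseteq T_i$ such that $|\mathcal{F}_S|\leq\binom{k-r}{i}|\mathcal{F}_{T_i}|$.
   Context: $\binom{[n]}{k}$ is the family of $k$-subsets of $[n]=\{1,\ldots,n\}$. $\mathcal{F}$ is $t$-intersecting if $|A\cap B|\geq t$ for all $A,B\in\mathcal{F}$. For a subset $S\subseteq[n]$, $\mathcal{F}_S=\{F\in\mathcal{F}: S\subseteq F\}$. -}

module Defs where

open import Data.Nat using (ℕ; _≤_)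
open import Data.List using (List; length; filter)
open import Data.List.Membership.Propositional using (_∈_)
open import Data.List.Relation.Unary.All using (All)
open import Data.List.Relation.Unary.Unique.Propositional using (Unique)
open import Data.Fin.Subset using (Subset; _⊆_; _∩_; ∣_∣)
open import Data.Fin.Subset.Properties using (_⊆?_)
open import Data.Product using (_×_)

record Family (n : ℕ) : Set where
  constructor family
  field
    members : List (Subset n)
    unique  : Unique members
open Family public

Uniform : ∀ {n} → ℕ → Family n → Set
Uniform k F = All (λ A → ∣ A ∣ ≡' k) (members F)
  where open import Relation.Binary.PropositionalEquality renaming (_≡_ to _≡'_)

TIntersecting : ∀ {n} → ℕ → Family n → Set
TIntersecting t F = ∀ {A B} → A ∈ members F → B ∈ members F → t ≤ ∣ A ∩ B ∣

restrictTo : ∀ {n} → Subset n → Family n → List (Subset n)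
restrictTo S F = filter (λ A → S ⊆? A) (members F)

∣F_∣ : ∀ {n} → Family n → Subset n → ℕ
∣F_∣ F S = length (restrictTo S F)

module Submission where

-- Fix F′ ∈ F with |S ∩ F′| = r and put D = F′ ∖ S, so that
-- |D| = k − r.  Every A ∈ F_S meets F′ in at least t elements, at most r
-- of which lie in S, so |A ∩ D| ≥ t − r ≥ i.  Hence A contains S ∪ I for
-- some i-subset I of D, and double counting gives
--     |F_S| ≤ Σ_{I ⊆ D, |I| = i} |F_{S ∪ I}| ≤ C(k − r, i) · |F_{S ∪ I₀}|
-- for an i-subset I₀ of D maximising |F_{S ∪ I}|.  Since I₀ is disjoint
-- from S, T = S ∪ I₀ has s + i elements.

open import Defs
open import Data.Nat using (ℕ; zero; suc; _≤_; _<_; _∸_; _*_; _+_; z≤n; s≤s)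
open import Data.Nat.Properties
open import Data.Nat.Combinatorics using (_C_; nCk+nC[k+1]≡[n+1]C[k+1])
open import Data.Nat.ListAction using (sum)
open import Data.Fin.Subset using (Subset; _⊆_; _∩_; _∪_; ∁; ∣_∣; inside; outside)
open import Data.Fin.Subset.Properties
  using (_⊆?_; ⊆-trans; drop-∷-⊆; out⊆; in⊆in; x∈p∪q⁻; p⊆p∪q; p∩q⊆q; ∣p∩q∣≤∣q∣; ∩-assoc; ∩-comm; ∩-idem)
open import Data.Vec using ([]; _∷_)
import Data.Vec as Vec
open import Data.List using (List; []; _∷_; [_]; map; _++_; length; filter)
open import Data.List.Properties using (length-map; length-++; filter-accept)
open import Data.List.Membership.Propositional using (_∈_; find)
open import Data.List.Membership.Propositional.Properties using (∈-map⁻; ∈-++⁻)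
open import Data.List.Relation.Unary.Any as Any using (Any; here; there)
open import Data.List.Relation.Unary.Any.Properties using (map⁺; ++⁺ˡ; ++⁺ʳ)
open import Data.List.Relation.Unary.All as All using (All; []; _∷_)
import Data.List.Extrema.Nat as Extrema
open import Data.Product using (Σ; _×_; _,_; proj₁; proj₂)
open import Data.Sum using (inj₁; inj₂)
open import Relation.Binary.PropositionalEquality using (_≡_; refl; sym; trans; cong; cong₂; subst; module ≡-Reasoning)
open import Relation.Nullary using (yes; no)
open import Relation.Unary using (Pred; Decidable)
open import Function using (_∘_)
open import Level using (0ℓ)

∣p∣≡∣q∩p∣+∣p∩∁q∣ : ∀ {n} (p q : Subset n) → ∣ p ∣ ≡ ∣ q ∩ p ∣ + ∣ p ∩ ∁ q ∣
∣p∣≡∣q∩p∣+∣p∩∁q∣ []            []            = refl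
∣p∣≡∣q∩p∣+∣p∩∁q∣ (outside ∷ p) (inside  ∷ q) = ∣p∣≡∣q∩p∣+∣p∩∁q∣ p q
∣p∣≡∣q∩p∣+∣p∩∁q∣ (outside ∷ p) (outside ∷ q) = ∣p∣≡∣q∩p∣+∣p∩∁q∣ p q
∣p∣≡∣q∩p∣+∣p∩∁q∣ (inside  ∷ p) (inside  ∷ q) = cong suc (∣p∣≡∣q∩p∣+∣p∩∁q∣ p q)
∣p∣≡∣q∩p∣+∣p∩∁q∣ (inside  ∷ p) (outside ∷ q) =
  trans (cong suc (∣p∣≡∣q∩p∣+∣p∩∁q∣ p q)) (sym (+-suc ∣ q ∩ p ∣ ∣ p ∩ ∁ q ∣))

-- Of the elements a shares with p, at most |q ∩ p| lie in q; the rest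
-- lie in p ∖ q.  This is what turns "t-intersecting" into a lower bound
-- on |A ∩ (F′ ∖ S)|.
∣a∩p∣≤∣a∩[p∩∁q]∣+∣q∩p∣ : ∀ {n} (a p q : Subset n) → ∣ a ∩ p ∣ ≤ ∣ a ∩ (p ∩ ∁ q) ∣ + ∣ q ∩ p ∣
∣a∩p∣≤∣a∩[p∩∁q]∣+∣q∩p∣ a p q = begin
  ∣ a ∩ p ∣                             ≡⟨ ∣p∣≡∣q∩p∣+∣p∩∁q∣ (a ∩ p) q ⟩
  ∣ q ∩ (a ∩ p) ∣ + ∣ (a ∩ p) ∩ ∁ q ∣   ≡⟨ cong₂ _+_ (cong ∣_∣ q∩[a∩p]≡a∩[q∩p]) (cong ∣_∣ (∩-assoc a p (∁ q))) ⟩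
  ∣ a ∩ (q ∩ p) ∣ + ∣ a ∩ (p ∩ ∁ q) ∣   ≤⟨ +-monoˡ-≤ _ (∣p∩q∣≤∣q∣ a (q ∩ p)) ⟩
  ∣ q ∩ p ∣ + ∣ a ∩ (p ∩ ∁ q) ∣         ≡⟨ +-comm ∣ q ∩ p ∣ _ ⟩
  ∣ a ∩ (p ∩ ∁ q) ∣ + ∣ q ∩ p ∣         ∎
  where
  open ≤-Reasoning
  q∩[a∩p]≡a∩[q∩p] : q ∩ (a ∩ p) ≡ a ∩ (q ∩ p)
  q∩[a∩p]≡a∩[q∩p] = trans (sym (∩-assoc q a p)) (trans (cong (_∩ p) (∩-comm q a)) (∩-assoc a q p))

∣p∩∁q∣≡∣p∣∸∣q∩p∣ : ∀ {n} (p q : Subset n) → ∣ p ∩ ∁ q ∣ ≡ ∣ p ∣ ∸ ∣ q ∩ p ∣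
∣p∩∁q∣≡∣p∣∸∣q∩p∣ p q = begin
  ∣ p ∩ ∁ q ∣                        ≡⟨ m+n∸m≡n ∣ q ∩ p ∣ ∣ p ∩ ∁ q ∣ ⟨
  ∣ q ∩ p ∣ + ∣ p ∩ ∁ q ∣ ∸ ∣ q ∩ p ∣  ≡⟨ cong (_∸ ∣ q ∩ p ∣) (∣p∣≡∣q∩p∣+∣p∩∁q∣ p q) ⟨
  ∣ p ∣ ∸ ∣ q ∩ p ∣                  ∎
  where open ≡-Reasoning

∣p∪q∣≡∣p∣+∣q∣ : ∀ {n} (p q : Subset n) → q ⊆ ∁ p → ∣ p ∪ q ∣ ≡ ∣ p ∣ + ∣ q ∣
∣p∪q∣≡∣p∣+∣q∣ []            []            _   = refl
∣p∪q∣≡∣p∣+∣q∣ (outside ∷ p) (outside ∷ q) q⊆∁p = ∣p∪q∣≡∣p∣+∣q∣ p q (drop-∷-⊆ q⊆∁p)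
∣p∪q∣≡∣p∣+∣q∣ (inside  ∷ p) (outside ∷ q) q⊆∁p = cong suc (∣p∪q∣≡∣p∣+∣q∣ p q (drop-∷-⊆ q⊆∁p))
∣p∪q∣≡∣p∣+∣q∣ (outside ∷ p) (inside  ∷ q) q⊆∁p =
  trans (cong suc (∣p∪q∣≡∣p∣+∣q∣ p q (drop-∷-⊆ q⊆∁p))) (sym (+-suc ∣ p ∣ ∣ q ∣))
∣p∪q∣≡∣p∣+∣q∣ (inside  ∷ p) (inside  ∷ q) q⊆∁p with q⊆∁p Vec.here
... | ()

∪-least : ∀ {n} {p q a : Subset n} → p ⊆ a → q ⊆ a → p ∪ q ⊆ a
∪-least {p = p} {q} p⊆a q⊆a x∈p∪q with x∈p∪q⁻ p q x∈p∪q
... | inj₁ x∈p = p⊆a x∈p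
... | inj₂ x∈q = q⊆a x∈q

subsetsOfSize : ∀ {n} → Subset n → ℕ → List (Subset n)
subsetsOfSize []            zero    = [ [] ]
subsetsOfSize []            (suc i) = []
subsetsOfSize (outside ∷ D) i       = map (outside ∷_) (subsetsOfSize D i)
subsetsOfSize (inside  ∷ D) zero    = map (outside ∷_) (subsetsOfSize D zero)
subsetsOfSize (inside  ∷ D) (suc i) =
  map (inside ∷_) (subsetsOfSize D i) ++ map (outside ∷_) (subsetsOfSize D (suc i))

length-subsetsOfSize : ∀ {n} (D : Subset n) i → length (subsetsOfSize D i) ≡ ∣ D ∣ C i
length-subsetsOfSize []            zero    = refl
length-subsetsOfSize []            (suc i) = refl
length-subsetsOfSize (outside ∷ D) i       =
  trans (length-map _ (subsetsOfSize D i)) (length-subsetsOfSize D i)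
length-subsetsOfSize (inside  ∷ D) zero    =
  trans (length-map _ (subsetsOfSize D zero)) (length-subsetsOfSize D zero)
length-subsetsOfSize (inside  ∷ D) (suc i) = begin
  length (map (inside ∷_) withFirst ++ map (outside ∷_) withoutFirst)
    ≡⟨ length-++ (map (inside ∷_) withFirst) ⟩
  length (map (inside ∷_) withFirst) + length (map (outside ∷_) withoutFirst)
    ≡⟨ cong₂ _+_ (length-map _ withFirst) (length-map _ withoutFirst) ⟩
  length withFirst + length withoutFirst
    ≡⟨ cong₂ _+_ (length-subsetsOfSize D i) (length-subsetsOfSize D (suc i)) ⟩
  ∣ D ∣ C i + ∣ D ∣ C suc i
    ≡⟨ nCk+nC[k+1]≡[n+1]C[k+1] ∣ D ∣ i ⟩
  suc ∣ D ∣ C suc i ∎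
  where
  open ≡-Reasoning
  withFirst withoutFirst : List (Subset _)
  withFirst    = subsetsOfSize D i
  withoutFirst = subsetsOfSize D (suc i)

∈-subsetsOfSize : ∀ {n} (D : Subset n) i {I} → I ∈ subsetsOfSize D i → ∣ I ∣ ≡ i × I ⊆ D
∈-subsetsOfSize []            zero (here refl) = refl , λ ()
∈-subsetsOfSize (outside ∷ D) i    I∈          with ∈-map⁻ _ I∈
... | I , I∈′ , refl with ∈-subsetsOfSize D i I∈′
...   | ∣I∣≡i , I⊆D = ∣I∣≡i , out⊆ I⊆D
∈-subsetsOfSize (inside  ∷ D) zero I∈          with ∈-map⁻ _ I∈
... | I , I∈′ , refl with ∈-subsetsOfSize D zero I∈′
...   | ∣I∣≡0 , I⊆D = ∣I∣≡0 , out⊆ I⊆D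
∈-subsetsOfSize (inside  ∷ D) (suc i) I∈ with ∈-++⁻ (map (inside ∷_) (subsetsOfSize D i)) I∈
... | inj₁ I∈withFirst with ∈-map⁻ _ I∈withFirst
...   | I , I∈′ , refl with ∈-subsetsOfSize D i I∈′
...     | ∣I∣≡i , I⊆D = cong suc ∣I∣≡i , in⊆in I⊆D
∈-subsetsOfSize (inside  ∷ D) (suc i) I∈ | inj₂ I∈withoutFirst with ∈-map⁻ _ I∈withoutFirst
...   | I , I∈′ , refl with ∈-subsetsOfSize D (suc i) I∈′
...     | ∣I∣≡1+i , I⊆D = ∣I∣≡1+i , out⊆ I⊆D

subsetsOfSize-meets : ∀ {n} (D A : Subset n) i → i ≤ ∣ A ∩ D ∣ →
                      Any (_⊆ A) (subsetsOfSize D i)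
subsetsOfSize-meets []            []            zero    _ = here λ ()
subsetsOfSize-meets (outside ∷ D) (a ∷ A)       i       i≤ =
  map⁺ (Any.map out⊆ (subsetsOfSize-meets D A i (subst (i ≤_) (drop-outside a) i≤)))
  where
  drop-outside : ∀ a → ∣ (a ∷ A) ∩ (outside ∷ D) ∣ ≡ ∣ A ∩ D ∣
  drop-outside outside = refl
  drop-outside inside  = refl
subsetsOfSize-meets (inside  ∷ D) (a ∷ A)       zero    _ =
  map⁺ (Any.map out⊆ (subsetsOfSize-meets D A zero z≤n))
subsetsOfSize-meets (inside  ∷ D) (inside  ∷ A) (suc i) (s≤s i≤) =
  ++⁺ˡ (map⁺ (Any.map in⊆in (subsetsOfSize-meets D A i i≤)))
subsetsOfSize-meets (inside  ∷ D) (outside ∷ A) (suc i) i≤ =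
  ++⁺ʳ (map (inside ∷_) (subsetsOfSize D i))
    (map⁺ (Any.map out⊆ (subsetsOfSize-meets D A (suc i) i≤)))

sum-map-mono-≤ : ∀ {Y : Set} {f g : Y → ℕ} → (∀ y → f y ≤ g y) →
                 ∀ ys → sum (map f ys) ≤ sum (map g ys)
sum-map-mono-≤ f≤g []       = z≤n
sum-map-mono-≤ f≤g (y ∷ ys) = +-mono-≤ (f≤g y) (sum-map-mono-≤ f≤g ys)

sum-map-mono-< : ∀ {Y : Set} {f g : Y → ℕ} → (∀ y → f y ≤ g y) →
                 ∀ ys → Any (λ y → f y < g y) ys → sum (map f ys) < sum (map g ys)
sum-map-mono-< f≤g (y ∷ ys) (here fy<gy) = +-mono-<-≤ fy<gy (sum-map-mono-≤ f≤g ys)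
sum-map-mono-< f≤g (y ∷ ys) (there any)  = +-mono-≤-< (f≤g y) (sum-map-mono-< f≤g ys any)

module _ {X : Set} {P : Pred X 0ℓ} (P? : Decidable P) where

  length-filter-∷-≤ : ∀ x xs → length (filter P? xs) ≤ length (filter P? (x ∷ xs))
  length-filter-∷-≤ x xs with P? x
  ... | yes _ = n≤1+n _
  ... | no  _ = ≤-refl

  length-filter-∷-< : ∀ {x} xs → P x → length (filter P? xs) < length (filter P? (x ∷ xs))
  length-filter-∷-< {x} xs Px rewrite filter-accept P? {x} {xs} Px = ≤-refl

length-filter-≤-sum : ∀ {X Y : Set} {Q : Pred X 0ℓ} (Q? : Decidable Q)
  {P : Y → Pred X 0ℓ} (P? : ∀ y → Decidable (P y)) (ys : List Y) (L : List X) →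
  (∀ {x} → x ∈ L → Q x → Any (λ y → P y x) ys) →
  length (filter Q? L) ≤ sum (map (λ y → length (filter (P? y) L)) ys)
length-filter-≤-sum Q? P? ys []      covered = z≤n
length-filter-≤-sum Q? P? ys (x ∷ L) covered with Q? x
... | yes Qx = ≤-trans (s≤s (length-filter-≤-sum Q? P? ys L (covered ∘ there)))
                       (sum-map-mono-< (λ y → length-filter-∷-≤ (P? y) x L) ys
                          (Any.map (length-filter-∷-< (P? _) L) (covered (here refl) Qx)))
... | no  _  = ≤-trans (length-filter-≤-sum Q? P? ys L (covered ∘ there))
                       (sum-map-mono-≤ (λ y → length-filter-∷-≤ (P? y) x L) ys)

sum-map-≤-length* : ∀ {Y : Set} (f : Y → ℕ) {B} ys → All (λ y → f y ≤ B) ys →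
                    sum (map f ys) ≤ length ys * B
sum-map-≤-length* f []       []           = z≤n
sum-map-≤-length* f (y ∷ ys) (fy≤B ∷ f≤B) = +-mono-≤ fy≤B (sum-map-≤-length* f ys f≤B)

sum≤length*max : ∀ {Y : Set} (f : Y → ℕ) ys {y₀} → y₀ ∈ ys →
                 Σ Y λ m → m ∈ ys × sum (map f ys) ≤ length ys * f m
sum≤length*max f ys {y₀} y₀∈ys =
  m , m∈ys , sum-map-≤-length* f ys (Extrema.f[xs]≤f[argmax] y₀ ys)
  where
  m = Extrema.argmax f y₀ ys
  m∈ys : m ∈ ys
  m∈ys with Extrema.argmax-sel f y₀ ys
  ... | inj₁ m≡y₀ = subst (_∈ ys) (sym m≡y₀) y₀∈ys
  ... | inj₂ m∈   = m∈

restriction-bound : ∀ {n} (F : Family n) (S D : Subset n) (i : ℕ) → i ≤ ∣ D ∣ →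
  (∀ {A} → A ∈ members F → S ⊆ A → i ≤ ∣ A ∩ D ∣) →
  Σ (Subset n) λ I → I ∈ subsetsOfSize D i × ∣F_∣ F S ≤ (∣ D ∣ C i) * ∣F_∣ F (S ∪ I)
restriction-bound {n} F S D i i≤∣D∣ meets-D = I , I∈Is , (begin
  ∣F_∣ F S                ≤⟨ length-filter-≤-sum (S ⊆?_) (λ I → S ∪ I ⊆?_) Is (members F) covered ⟩
  sum (map weight Is)     ≤⟨ sum≤length*weight ⟩
  length Is * weight I    ≡⟨ cong (_* weight I) (length-subsetsOfSize D i) ⟩
  (∣ D ∣ C i) * weight I  ∎)
  where
  open ≤-Reasoning
  Is : List (Subset n)
  Is = subsetsOfSize D i
  weight : Subset n → ℕ
  weight I = ∣F_∣ F (S ∪ I)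
  covered : ∀ {A} → A ∈ members F → S ⊆ A → Any (λ I → S ∪ I ⊆ A) Is
  covered A∈F S⊆A = Any.map (∪-least S⊆A) (subsetsOfSize-meets D _ i (meets-D A∈F S⊆A))
  nonempty : Any (_⊆ D) Is
  nonempty = subsetsOfSize-meets D D i (subst (i ≤_) (cong ∣_∣ (sym (∩-idem D))) i≤∣D∣)
  heaviest : Σ (Subset n) λ I → I ∈ Is × sum (map weight Is) ≤ length Is * weight I
  heaviest = sum≤length*max weight Is (proj₁ (proj₂ (find nonempty)))
  I : Subset n
  I = proj₁ heaviest
  I∈Is : I ∈ Is
  I∈Is = proj₁ (proj₂ heaviest)
  sum≤length*weight : sum (map weight Is) ≤ length Is * weight I
  sum≤length*weight = proj₂ (proj₂ heaviest)

t-intersecting⇒meets-difference : ∀ {n t} (F : Family n) → TIntersecting t F →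
  ∀ (S : Subset n) {A F′} → A ∈ members F → F′ ∈ members F →
  t ∸ ∣ S ∩ F′ ∣ ≤ ∣ A ∩ (F′ ∩ ∁ S) ∣
t-intersecting⇒meets-difference {t = t} F t-intersecting S {A} {F′} A∈F F′∈F = begin
  t ∸ r                            ≤⟨ ∸-monoˡ-≤ r (≤-trans (t-intersecting A∈F F′∈F) (∣a∩p∣≤∣a∩[p∩∁q]∣+∣q∩p∣ A F′ S)) ⟩
  ∣ A ∩ (F′ ∩ ∁ S) ∣ + r ∸ r       ≡⟨ m+n∸n≡m ∣ A ∩ (F′ ∩ ∁ S) ∣ r ⟩
  ∣ A ∩ (F′ ∩ ∁ S) ∣               ∎
  where
  open ≤-Reasoning
  r : ℕ
  r = ∣ S ∩ F′ ∣

lemma3p1 : (n k t s r : ℕ) (F : Family n) (S : Subset n)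
    → Uniform k F
    → TIntersecting t F
    → ∣ S ∣ ≡ s
    → t ≤ s + 1
    → s + 1 ≤ k
    → (Σ (Subset n) λ F′ → F′ ∈ members F × ∣ S ∩ F′ ∣ ≡ r)
    → r + 1 ≤ t
    → (i : ℕ) → 1 ≤ i → i ≤ t ∸ r
    → Σ (Subset n) λ T → ∣ T ∣ ≡ s + i × S ⊆ T × ∣F_∣ F S ≤ ((k ∸ r) C i) * ∣F_∣ F T
lemma3p1 n k t s r F S uniform t-intersecting refl t≤s+1 s+1≤k (F′ , F′∈F , refl) _ i _ i≤t∸r =
  S ∪ I , ∣S∪I∣≡s+i , p⊆p∪q I , subst (λ m → ∣F_∣ F S ≤ (m C i) * ∣F_∣ F (S ∪ I)) ∣D∣≡k∸r bound
  where
  D : Subset n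
  D = F′ ∩ ∁ S
  ∣D∣≡k∸r : ∣ D ∣ ≡ k ∸ r
  ∣D∣≡k∸r = trans (∣p∩∁q∣≡∣p∣∸∣q∩p∣ F′ S) (cong (_∸ r) (All.lookup uniform F′∈F))
  i≤∣D∣ : i ≤ ∣ D ∣
  i≤∣D∣ = subst (i ≤_) (sym ∣D∣≡k∸r) (≤-trans i≤t∸r (∸-monoˡ-≤ r (≤-trans t≤s+1 s+1≤k)))
  meets-D : ∀ {A} → A ∈ members F → S ⊆ A → i ≤ ∣ A ∩ D ∣
  meets-D A∈F _ = ≤-trans i≤t∸r (t-intersecting⇒meets-difference F t-intersecting S A∈F F′∈F)
  core : Σ (Subset n) λ I → I ∈ subsetsOfSize D i × ∣F_∣ F S ≤ (∣ D ∣ C i) * ∣F_∣ F (S ∪ I)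
  core = restriction-bound F S D i i≤∣D∣ meets-D
  I : Subset n
  I = proj₁ core
  bound : ∣F_∣ F S ≤ (∣ D ∣ C i) * ∣F_∣ F (S ∪ I)
  bound = proj₂ (proj₂ core)
  ∣S∪I∣≡s+i : ∣ S ∪ I ∣ ≡ ∣ S ∣ + i
  ∣S∪I∣≡s+i with ∈-subsetsOfSize D i (proj₁ (proj₂ core))
  ... | ∣I∣≡i , I⊆D = trans (∣p∪q∣≡∣p∣+∣q∣ S I (⊆-trans I⊆D (p∩q⊆q F′ (∁ S)))) (cong (∣ S ∣ +_) ∣I∣≡i)
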